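{- Let $t$ be a closed $\rhd\beta_v$-normalizable term and $t_0$ its $\rhd\beta_v$-normal form. For all reduction sequences $d$ and $d'$ from $t$ to $t_0$ consisting of $\rhd\beta_v$-steps, $d$ and $d'$ have the same number of $\rhd\beta_v$-steps.
   Context: Terms: $t ::= x \mid \lambda x.t \mid tu$ (up to $\alpha$); values $v ::= x \mid \lambda x.t$; closed means no free variables; $t\{v/x\}$ substitution. Root step ($\beta_v$): $(\lambda x.t)v \mapsto t\{v/x\}$ with $v$ a value. Balanced contexts $B ::= [\cdot] \mid (\lambda x.B)t \mid Bt \mid tB$; $\rhd\beta_v$-reduction is the closure of the root step under balanced contexts. -}

module Defs where

open import Data.Nat using (ℕ; zero; suc)
open import Data.Fin using (Fin; zero; suc)
open import Relation.Nullary using (¬_)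
open import Data.Product using (∃; _×_)

-- λ-terms with de Bruijn indices (terms up to α-equivalence);
-- Term n = terms whose free variables are among n
data Term (n : ℕ) : Set where
  var : Fin n → Term n
  lam : Term (suc n) → Term n
  app : Term n → Term n → Term n

Closed : Set
Closed = Term 0

data Value {n : ℕ} : Term n → Set where
  var : (x : Fin n) → Value (var x)
  lam : (t : Term (suc n)) → Value (lam t)

Ren : ℕ → ℕ → Set
Ren m n = Fin m → Fin n

ext : ∀ {m n} → Ren m n → Ren (suc m) (suc n)
ext ρ zero = zero
ext ρ (suc x) = suc (ρ x)

rename : ∀ {m n} → Ren m n → Term m → Term n
rename ρ (var x) = var (ρ x)
rename ρ (lam t) = lam (rename (ext ρ) t)
rename ρ (app t u) = app (rename ρ t) (rename ρ u)

Sub : ℕ → ℕ → Set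
Sub m n = Fin m → Term n

exts : ∀ {m n} → Sub m n → Sub (suc m) (suc n)
exts σ zero = var zero
exts σ (suc x) = rename suc (σ x)

subst : ∀ {m n} → Sub m n → Term m → Term n
subst σ (var x) = σ x
subst σ (lam t) = lam (subst (exts σ) t)
subst σ (app t u) = app (subst σ t) (subst σ u)

-- single substitution t{v/x} where x is the variable bound by the outer λ
sub0 : ∀ {n} → Term n → Sub (suc n) n
sub0 v zero = v
sub0 v (suc x) = var x

_[_] : ∀ {n} → Term (suc n) → Term n → Term n
t [ v ] = subst (sub0 v) t

-- ▷β_v-step: closure of the root β_v step under balanced contexts
-- B ::= [·] | (λx.B)t | Bt | tB
data _⇒_ {n : ℕ} : Term n → Term n → Set where
  root  : ∀ {t v} → Value v → app (lam t) v ⇒ (t [ v ])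
  balλ  : ∀ {t t' u} → t ⇒ t' → app (lam t) u ⇒ app (lam t') u
  appL  : ∀ {t t' u} → t ⇒ t' → app t u ⇒ app t' u
  appR  : ∀ {t u u'} → u ⇒ u' → app t u ⇒ app t u'

data Steps {n : ℕ} : ℕ → Term n → Term n → Set where
  done : ∀ {t} → Steps zero t t
  step : ∀ {k t u w} → t ⇒ u → Steps k u w → Steps (suc k) t w

Normal : ∀ {n} → Term n → Set
Normal {n} t = ∀ {u : Term n} → ¬ (t ⇒ u)

IsNormalFormOf : ∀ {n} → Term n → Term n → Set
IsNormalFormOf t t0 = Normal t0 × ∃ λ k → Steps k t t0

-- ▷β_v has the diamond property: two different one-step reducts of a term
-- meet again after exactly one more step on each side. A balanced context
-- puts a hole under a λ only in the function part of an applied abstraction,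
-- so a root step and an inner step always commute: the inner step survives
-- the substitution of a value. Given the diamond property, the first step of
-- one reduction sequence to a normal form can be moved to the front of any
-- other one without changing its length, so by induction all such sequences
-- have the same length.
module Submission where

open import Defs
open import Data.Nat using (ℕ; zero; suc)
open import Data.Fin using (zero; suc)
open import Data.Empty using (⊥-elim)
open import Data.Sum using (_⊎_; inj₁; inj₂)
open import Data.Product using (∃-syntax; _×_; _,_)
open import Relation.Binary.PropositionalEquality
  using (_≡_; _≗_; refl; sym; trans; cong; cong₂; module ≡-Reasoning)

private
  variable
    l m n k k' : ℕ

ext-cong : {ρ ρ' : Ren m n} → ρ ≗ ρ' → ext ρ ≗ ext ρ'
ext-cong e zero = refl
ext-cong e (suc x) = cong suc (e x)

rename-cong : {ρ ρ' : Ren m n} → ρ ≗ ρ' → rename ρ ≗ rename ρ'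
rename-cong e (var x) = cong var (e x)
rename-cong e (lam t) = cong lam (rename-cong (ext-cong e) t)
rename-cong e (app t u) = cong₂ app (rename-cong e t) (rename-cong e u)

exts-cong : {σ σ' : Sub m n} → σ ≗ σ' → exts σ ≗ exts σ'
exts-cong e zero = refl
exts-cong e (suc x) = cong (rename suc) (e x)

subst-cong : {σ σ' : Sub m n} → σ ≗ σ' → subst σ ≗ subst σ'
subst-cong e (var x) = e x
subst-cong e (lam t) = cong lam (subst-cong (exts-cong e) t)
subst-cong e (app t u) = cong₂ app (subst-cong e t) (subst-cong e u)

rename-∘ : (ρ : Ren m n) (ρ' : Ren l m) (t : Term l) →
           rename ρ (rename ρ' t) ≡ rename (λ x → ρ (ρ' x)) t
rename-∘ ρ ρ' (var x) = refl
rename-∘ ρ ρ' (lam t) =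
  cong lam (trans (rename-∘ (ext ρ) (ext ρ') t)
                  (rename-cong (λ { zero → refl ; (suc x) → refl }) t))
rename-∘ ρ ρ' (app t u) = cong₂ app (rename-∘ ρ ρ' t) (rename-∘ ρ ρ' u)

rename-subst : (ρ : Ren m n) (σ : Sub l m) (t : Term l) →
               rename ρ (subst σ t) ≡ subst (λ x → rename ρ (σ x)) t
rename-subst ρ σ (var x) = refl
rename-subst ρ σ (lam t) =
  cong lam (trans (rename-subst (ext ρ) (exts σ) t) (subst-cong ext-exts t))
  where
  ext-exts : (λ x → rename (ext ρ) (exts σ x)) ≗ exts (λ x → rename ρ (σ x))
  ext-exts zero = refl
  ext-exts (suc x) = trans (rename-∘ (ext ρ) suc (σ x)) (sym (rename-∘ suc ρ (σ x)))
rename-subst ρ σ (app t u) = cong₂ app (rename-subst ρ σ t) (rename-subst ρ σ u)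

subst-rename : (σ : Sub m n) (ρ : Ren l m) (t : Term l) →
               subst σ (rename ρ t) ≡ subst (λ x → σ (ρ x)) t
subst-rename σ ρ (var x) = refl
subst-rename σ ρ (lam t) =
  cong lam (trans (subst-rename (exts σ) (ext ρ) t)
                  (subst-cong (λ { zero → refl ; (suc x) → refl }) t))
subst-rename σ ρ (app t u) = cong₂ app (subst-rename σ ρ t) (subst-rename σ ρ u)

subst-∘ : (σ : Sub m n) (τ : Sub l m) (t : Term l) →
          subst σ (subst τ t) ≡ subst (λ x → subst σ (τ x)) t
subst-∘ σ τ (var x) = refl
subst-∘ σ τ (lam t) =
  cong lam (trans (subst-∘ (exts σ) (exts τ) t) (subst-cong exts-exts t))
  where
  exts-exts : (λ x → subst (exts σ) (exts τ x)) ≗ exts (λ x → subst σ (τ x))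
  exts-exts zero = refl
  exts-exts (suc x) = trans (subst-rename (exts σ) suc (τ x)) (sym (rename-subst suc σ (τ x)))
subst-∘ σ τ (app t u) = cong₂ app (subst-∘ σ τ t) (subst-∘ σ τ u)

subst-id : (t : Term n) → subst var t ≡ t
subst-id (var x) = refl
subst-id (lam t) =
  cong lam (trans (subst-cong (λ { zero → refl ; (suc x) → refl }) t) (subst-id t))
subst-id (app t u) = cong₂ app (subst-id t) (subst-id u)

subst-[] : (σ : Sub m n) (t : Term (suc m)) (v : Term m) →
           (subst (exts σ) t) [ subst σ v ] ≡ subst σ (t [ v ])
subst-[] σ t v = begin
  (subst (exts σ) t) [ subst σ v ]                    ≡⟨ subst-∘ _ _ t ⟩
  subst (λ x → subst (sub0 (subst σ v)) (exts σ x)) t ≡⟨ subst-cong sub0-exts t ⟩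
  subst (λ x → subst σ (sub0 v x)) t                  ≡⟨ sym (subst-∘ _ _ t) ⟩
  subst σ (t [ v ])                                   ∎
  where
  open ≡-Reasoning
  sub0-exts : (λ x → subst (sub0 (subst σ v)) (exts σ x)) ≗ (λ x → subst σ (sub0 v x))
  sub0-exts zero = refl
  sub0-exts (suc x) = trans (subst-rename _ suc (σ x)) (subst-id (σ x))

ValueSub : Sub m n → Set
ValueSub σ = ∀ x → Value (σ x)

rename-value : (ρ : Ren m n) {v : Term m} → Value v → Value (rename ρ v)
rename-value ρ (var x) = var (ρ x)
rename-value ρ (lam t) = lam _

exts-value : {σ : Sub m n} → ValueSub σ → ValueSub (exts σ)
exts-value vσ zero = var zero
exts-value vσ (suc x) = rename-value suc (vσ x)

subst-value : {σ : Sub m n} → ValueSub σ → {v : Term m} → Value v → Value (subst σ v)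
subst-value vσ (var x) = vσ x
subst-value vσ (lam t) = lam _

sub0-value : {v : Term n} → Value v → ValueSub (sub0 v)
sub0-value vv zero = vv
sub0-value vv (suc x) = var x

subst-⇒ : {σ : Sub m n} → ValueSub σ → {t t' : Term m} → t ⇒ t' → subst σ t ⇒ subst σ t'
subst-⇒ {σ = σ} vσ (root {t} {v} vv) with root {t = subst (exts σ) t} (subst-value vσ vv)
... | r rewrite subst-[] σ t v = r
subst-⇒ vσ (balλ s) = balλ (subst-⇒ (exts-value vσ) s)
subst-⇒ vσ (appL s) = appL (subst-⇒ vσ s)
subst-⇒ vσ (appR s) = appR (subst-⇒ vσ s)

[]-⇒ : {t t' : Term (suc n)} {v : Term n} → Value v → t ⇒ t' → (t [ v ]) ⇒ (t' [ v ])
[]-⇒ vv = subst-⇒ (sub0-value vv)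

value-normal : {v : Term n} → Value v → Normal v
value-normal (var x) ()
value-normal (lam t) ()

JoinableIn1 : Term n → Term n → Set
JoinableIn1 u₁ u₂ = u₁ ≡ u₂ ⊎ ∃[ w ] (u₁ ⇒ w × u₂ ⇒ w)

joinableIn1-map : (C : Term m → Term n) → (∀ {a b} → a ⇒ b → C a ⇒ C b) →
                  {u₁ u₂ : Term m} → JoinableIn1 u₁ u₂ → JoinableIn1 (C u₁) (C u₂)
joinableIn1-map C C-⇒ (inj₁ refl) = inj₁ refl
joinableIn1-map C C-⇒ (inj₂ (w , s₁ , s₂)) = inj₂ (C w , C-⇒ s₁ , C-⇒ s₂)

swap-joinableIn1 : {u₁ u₂ : Term n} → JoinableIn1 u₁ u₂ → JoinableIn1 u₂ u₁
swap-joinableIn1 (inj₁ refl) = inj₁ refl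
swap-joinableIn1 (inj₂ (w , s₁ , s₂)) = inj₂ (w , s₂ , s₁)

⇒-diamond : {t u₁ u₂ : Term n} → t ⇒ u₁ → t ⇒ u₂ → JoinableIn1 u₁ u₂
⇒-diamond (root vv) (root _) = inj₁ refl
⇒-diamond (root vv) (balλ s) = inj₂ (_ , []-⇒ vv s , root vv)
⇒-diamond (root vv) (appR s) = ⊥-elim (value-normal vv s)
⇒-diamond (balλ s) (balλ s') = joinableIn1-map (λ t → app (lam t) _) balλ (⇒-diamond s s')
⇒-diamond (balλ s) (appR s') = inj₂ (_ , appR s' , balλ s)
⇒-diamond (appL s) (appL s') = joinableIn1-map (λ t → app t _) appL (⇒-diamond s s')
⇒-diamond (appL s) (appR s') = inj₂ (_ , appR s' , appL s)
⇒-diamond (appR s) (appR s') = joinableIn1-map (app _) appR (⇒-diamond s s')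
⇒-diamond s@(balλ _) s'@(root _) = swap-joinableIn1 (⇒-diamond s' s)
⇒-diamond s@(appR _) s'@(root _) = swap-joinableIn1 (⇒-diamond s' s)
⇒-diamond s@(appR _) s'@(balλ _) = swap-joinableIn1 (⇒-diamond s' s)
⇒-diamond s@(appR _) s'@(appL _) = swap-joinableIn1 (⇒-diamond s' s)

steps-after-step : {t u nf : Term n} → Normal nf →
                   Steps (suc k) t nf → t ⇒ u → Steps k u nf
steps-after-step N (step s d) s' with ⇒-diamond s s'
... | inj₁ refl = d
steps-after-step N (step s done) s' | inj₂ (w , s↓ , _) = ⊥-elim (N s↓)
steps-after-step N (step s d@(step _ _)) s' | inj₂ (w , s↓ , s'↓) =
  step s'↓ (steps-after-step N d s↓)

steps-to-normal-length : {t nf : Term n} → Normal nf →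
                         Steps k t nf → Steps k' t nf → k ≡ k'
steps-to-normal-length N done done = refl
steps-to-normal-length N done (step s _) = ⊥-elim (N s)
steps-to-normal-length N (step s _) done = ⊥-elim (N s)
steps-to-normal-length N (step s d) d'@(step _ _) =
  cong suc (steps-to-normal-length N d (steps-after-step N d' s))

mainTheorem7 : (t t0 : Closed) → IsNormalFormOf t t0 →
    ∀ {k k' : ℕ} (d : Steps k t t0) (d' : Steps k' t t0) → k ≡ k'
mainTheorem7 t t0 (t0-normal , _) d d' = steps-to-normal-length t0-normal d d'
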